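{- Let $q$ be a prime power and let $B=\bigcup_{i\in\mathbb{F}_q\cup\{\infty\}} l(i,b_i)$ ($b_i\in\mathbb{F}_q$) be a minimal Besicovitch arrangement in $\mathbb{F}_q^2$. Then \[x_0^B+x_1^B+x_2^B\le q^2,\qquad 3x_0^B-x_2^B\le q^2-2q,\qquad 3x_0^B+2x_1^B+x_2^B\ge 2q^2-q.\]
   Context: For $s\in\mathbb{F}_q$ and $b\in\mathbb{F}_q$, $l(s,b)$ denotes the line $y=sx+b$ in $\mathbb{F}_q^2$, and $l(\infty,b)$ the line $x=b$. A minimal Besicovitch arrangement is a set of exactly $q+1$ lines in $\mathbb{F}_q^2$, one in each direction $i\in\mathbb{F}_q\cup\{\infty\}$. For such $B$, $x_m^B$ is the number of points of $\mathbb{F}_q^2$ through which exactly $m$ lines of $B$ pass. -}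

module Defs where

open import Level using (0ℓ)
open import Data.Nat using (ℕ; zero; suc)
open import Data.Fin using (Fin)
open import Data.Fin.Properties using (all?)
open import Data.Maybe using (Maybe; just; nothing)
open import Data.Product using (Σ; _×_; _,_)
open import Data.List using (List; _∷_; map; filter; length; cartesianProduct)
open import Data.List.Base using (allFin)
open import Function.Bundles using (_↔_; Inverse)
open import Relation.Nullary using (¬_; Dec; yes; no)
open import Relation.Binary.PropositionalEquality using (_≡_)
open import Relation.Binary.Definitions using (DecidableEquality)
open import Algebra.Structures using (IsCommutativeRing)
import Data.Nat.Properties as ℕP

-- A finite field with exactly q elements (equality is propositional equality).
-- Its order q is then necessarily a prime power; this is how "F_q" is rendered.
record FiniteField (q : ℕ) : Set₁ where
  field
    Carrier : Set
    _+_ _*_ : Carrier → Carrier → Carrier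
    -_ : Carrier → Carrier
    0# 1# : Carrier
    isCommutativeRing : IsCommutativeRing _≡_ _+_ _*_ -_ 0# 1#
    0≢1 : ¬ (0# ≡ 1#)
    inverse : ∀ x → ¬ (x ≡ 0#) → Σ Carrier (λ y → x * y ≡ 1#)
    _≟_ : DecidableEquality Carrier
    enum : Fin q ↔ Carrier

  elems : List Carrier
  elems = map (Inverse.to enum) (allFin q)

  -- directions: nothing = ∞, just s = slope s
  Direction : Set
  Direction = Maybe Carrier

  directions : List Direction
  directions = nothing ∷ map just elems

  Point : Set
  Point = Carrier × Carrier

  points : List Point
  points = cartesianProduct elems elems

  OnLine : Direction → Carrier → Point → Set
  OnLine (just s) b (x , y) = y ≡ (s * x) + b
  OnLine nothing  b (x , y) = x ≡ b

  onLine? : ∀ i b p → Dec (OnLine i b p)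
  onLine? (just s) b (x , y) = y ≟ ((s * x) + b)
  onLine? nothing  b (x , y) = x ≟ b

  -- A minimal Besicovitch arrangement is given by its intercepts b_i,
  -- one line l(i, b i) for each direction i ∈ F_q ∪ {∞}.
  Arrangement : Set
  Arrangement = Direction → Carrier

  linesThrough : Arrangement → Point → ℕ
  linesThrough B p = length (filter (λ i → onLine? i (B i) p) directions)

  x[_]^ : ℕ → Arrangement → ℕ
  x[ m ]^ B = length (filter (λ p → linesThrough B p ℕP.≟ m) points)

-- Let t(p) be the number of lines of B through p.  Double counting incidences
-- gives the moments Σ_p 1 = q², Σ_p t(p) = (q+1)q (every line has q points) and
-- Σ_p t(p)² = Σ_{i,j} |l_i ∩ l_j| = (q+1)·2q (a line meets itself in q points and
-- each of the q other lines in exactly one).  Each inequality is then the sum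
-- over all points of a pointwise inequality in n = t(p):
--   [n=0] + [n=1] + [n=2] ≤ 1,   3[n=0] - [n=2] ≤ (n-1)(n-3),   3 - n ≤ 3[n=0] + 2[n=1] + [n=2].
module Submission where

open import Defs

open import Data.Nat as ℕ using (ℕ; zero; suc; z≤n; s≤s)
import Data.Nat.Properties as ℕP
open import Data.Nat.Tactic.RingSolver using (solve-∀)
open import Data.Fin as Fin using (Fin)
import Data.Fin.Properties as FinP
open import Data.List using (List; []; _∷_; _++_; map; filter; length; tabulate; allFin; cartesianProduct)
open import Data.List.Properties using (length-map; length-++; length-tabulate)
open import Data.Maybe using (Maybe; just; nothing)
import Data.Maybe.Properties as MaybeP
open import Data.Product using (Σ; _×_; _,_; proj₁; proj₂)
open import Data.Empty using (⊥-elim)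
open import Function using (_∘_)
open import Function.Bundles using (_⇔_; mk⇔; Inverse; _↔_; Equivalence)
open import Relation.Nullary using (Dec; yes; no; ¬_)
open import Relation.Unary using (Pred; Decidable)
open import Relation.Binary.Definitions using (DecidableEquality)
open import Relation.Binary.PropositionalEquality
open import Algebra.Bundles using (CommutativeRing)

∑ : ∀ {a} {A : Set a} → List A → (A → ℕ) → ℕ
∑ []       f = 0
∑ (x ∷ xs) f = f x ℕ.+ ∑ xs f

infix 5 ∑
syntax ∑ xs (λ x → e) = ∑[ x ∈ xs ] e

module _ {a} {A : Set a} where

  ∑-cong : ∀ (xs : List A) {f g : A → ℕ} → (∀ x → f x ≡ g x) → ∑ xs f ≡ ∑ xs g
  ∑-cong []       f≡g = refl
  ∑-cong (x ∷ xs) f≡g = cong₂ ℕ._+_ (f≡g x) (∑-cong xs f≡g)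

  ∑-mono : ∀ (xs : List A) {f g : A → ℕ} → (∀ x → f x ℕ.≤ g x) → ∑ xs f ℕ.≤ ∑ xs g
  ∑-mono []       f≤g = z≤n
  ∑-mono (x ∷ xs) f≤g = ℕP.+-mono-≤ (f≤g x) (∑-mono xs f≤g)

  ∑-+ : ∀ (xs : List A) (f g : A → ℕ) → (∑[ x ∈ xs ] (f x ℕ.+ g x)) ≡ ∑ xs f ℕ.+ ∑ xs g
  ∑-+ []       f g = refl
  ∑-+ (x ∷ xs) f g = trans (cong (f x ℕ.+ g x ℕ.+_) (∑-+ xs f g)) (swap-middle (f x) (g x) _ _)
    where
    swap-middle : ∀ a b c d → a ℕ.+ b ℕ.+ (c ℕ.+ d) ≡ a ℕ.+ c ℕ.+ (b ℕ.+ d)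
    swap-middle = solve-∀

  ∑-*ˡ : ∀ (xs : List A) c (f : A → ℕ) → (∑[ x ∈ xs ] (c ℕ.* f x)) ≡ c ℕ.* ∑ xs f
  ∑-*ˡ []       c f = sym (ℕP.*-zeroʳ c)
  ∑-*ˡ (x ∷ xs) c f = trans (cong (c ℕ.* f x ℕ.+_) (∑-*ˡ xs c f)) (sym (ℕP.*-distribˡ-+ c (f x) _))

  ∑-*ʳ : ∀ (xs : List A) c (f : A → ℕ) → (∑[ x ∈ xs ] (f x ℕ.* c)) ≡ ∑ xs f ℕ.* c
  ∑-*ʳ xs c f = trans (∑-cong xs (λ x → ℕP.*-comm (f x) c)) (trans (∑-*ˡ xs c f) (ℕP.*-comm c _))

  ∑-const : ∀ (xs : List A) c → (∑[ _ ∈ xs ] c) ≡ length xs ℕ.* c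
  ∑-const []       c = refl
  ∑-const (x ∷ xs) c = cong (c ℕ.+_) (∑-const xs c)

  ∑-vanish : ∀ (xs : List A) {f : A → ℕ} → (∀ x → f x ≡ 0) → ∑ xs f ≡ 0
  ∑-vanish xs f≡0 = trans (∑-cong xs f≡0) (trans (∑-const xs 0) (ℕP.*-zeroʳ (length xs)))

  ∑-++ : ∀ (xs ys : List A) f → ∑ (xs ++ ys) f ≡ ∑ xs f ℕ.+ ∑ ys f
  ∑-++ []       ys f = refl
  ∑-++ (x ∷ xs) ys f = trans (cong (f x ℕ.+_) (∑-++ xs ys f)) (sym (ℕP.+-assoc (f x) _ _))

∑-map : ∀ {a b} {A : Set a} {B : Set b} (h : A → B) xs (f : B → ℕ) →
  ∑ (map h xs) f ≡ (∑[ x ∈ xs ] f (h x))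
∑-map h []       f = refl
∑-map h (x ∷ xs) f = cong (f (h x) ℕ.+_) (∑-map h xs f)

module _ {a b} {A : Set a} {B : Set b} where

  ∑-swap : ∀ (xs : List A) (ys : List B) (f : A → B → ℕ) →
    (∑[ x ∈ xs ] ∑[ y ∈ ys ] f x y) ≡ (∑[ y ∈ ys ] ∑[ x ∈ xs ] f x y)
  ∑-swap []       ys f = sym (∑-vanish ys (λ _ → refl))
  ∑-swap (x ∷ xs) ys f =
    trans (cong (∑ ys (f x) ℕ.+_) (∑-swap xs ys f)) (sym (∑-+ ys (f x) _))

  ∑-cartesianProduct : ∀ (xs : List A) (ys : List B) (f : A × B → ℕ) →
    ∑ (cartesianProduct xs ys) f ≡ (∑[ x ∈ xs ] ∑[ y ∈ ys ] f (x , y))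
  ∑-cartesianProduct []       ys f = refl
  ∑-cartesianProduct (x ∷ xs) ys f =
    trans (∑-++ (map (x ,_) ys) _ f) (cong₂ ℕ._+_ (∑-map (x ,_) ys f) (∑-cartesianProduct xs ys f))

  length-cartesianProduct : ∀ (xs : List A) (ys : List B) →
    length (cartesianProduct xs ys) ≡ length xs ℕ.* length ys
  length-cartesianProduct []       ys = refl
  length-cartesianProduct (x ∷ xs) ys = begin
    length (map (x ,_) ys ++ cartesianProduct xs ys)       ≡⟨ length-++ (map (x ,_) ys) ⟩
    length (map (x ,_) ys) ℕ.+ length (cartesianProduct xs ys) ≡⟨ cong₂ ℕ._+_ (length-map (x ,_) ys) (length-cartesianProduct xs ys) ⟩
    length ys ℕ.+ length xs ℕ.* length ys                  ∎
    where open ≡-Reasoning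

∑-tabulate : ∀ {a} {A : Set a} {n} (h : Fin n → A) f → ∑ (tabulate h) f ≡ (∑[ k ∈ allFin n ] f (h k))
∑-tabulate {n = zero}  h f = refl
∑-tabulate {n = suc n} h f =
  cong (f (h Fin.zero) ℕ.+_) (trans (∑-tabulate (h ∘ Fin.suc) f) (sym (∑-tabulate Fin.suc (f ∘ h))))

𝟙 : ∀ {p} {P : Set p} → Dec P → ℕ
𝟙 (yes _) = 1
𝟙 (no _)  = 0

𝟙-cong : ∀ {p q} {P : Set p} {Q : Set q} → P ⇔ Q → (P? : Dec P) (Q? : Dec Q) → 𝟙 P? ≡ 𝟙 Q?
𝟙-cong P⇔Q (yes _)  (yes _)  = refl
𝟙-cong P⇔Q (yes p)  (no ¬q)  = ⊥-elim (¬q (Equivalence.to P⇔Q p))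
𝟙-cong P⇔Q (no ¬p)  (yes q)  = ⊥-elim (¬p (Equivalence.from P⇔Q q))
𝟙-cong P⇔Q (no _)   (no _)   = refl

𝟙-idem : ∀ {p} {P : Set p} (P? : Dec P) → 𝟙 P? ℕ.* 𝟙 P? ≡ 𝟙 P?
𝟙-idem (yes _) = refl
𝟙-idem (no _)  = refl

length-filter : ∀ {a p} {A : Set a} {P : Pred A p} (P? : Decidable P) xs →
  length (filter P? xs) ≡ (∑[ x ∈ xs ] 𝟙 (P? x))
length-filter P? []       = refl
length-filter P? (x ∷ xs) with P? x
... | yes _ = cong suc (length-filter P? xs)
... | no _  = length-filter P? xs

module _ {a} {A : Set a} (_≟_ : DecidableEquality A) where

  Enumerates : List A → Set a
  Enumerates xs = ∀ c → (∑[ y ∈ xs ] 𝟙 (y ≟ c)) ≡ 1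

  sift : ∀ xs → Enumerates xs → ∀ c (g : A → ℕ) → (∑[ y ∈ xs ] 𝟙 (y ≟ c) ℕ.* g y) ≡ g c
  sift xs enum c g = begin
    (∑[ y ∈ xs ] 𝟙 (y ≟ c) ℕ.* g y) ≡⟨ ∑-cong xs at-c ⟩
    (∑[ y ∈ xs ] 𝟙 (y ≟ c) ℕ.* g c) ≡⟨ ∑-*ʳ xs (g c) (λ y → 𝟙 (y ≟ c)) ⟩
    (∑[ y ∈ xs ] 𝟙 (y ≟ c)) ℕ.* g c ≡⟨ cong (ℕ._* g c) (enum c) ⟩
    1 ℕ.* g c                       ≡⟨ ℕP.*-identityˡ (g c) ⟩
    g c                             ∎
    where
    open ≡-Reasoning
    at-c : ∀ y → 𝟙 (y ≟ c) ℕ.* g y ≡ 𝟙 (y ≟ c) ℕ.* g c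
    at-c y with y ≟ c
    ... | yes refl = refl
    ... | no _     = refl

allFin-enumerates : ∀ n → Enumerates FinP._≟_ (allFin n)
allFin-enumerates (suc n) Fin.zero =
  cong suc (trans (∑-tabulate {n = n} Fin.suc (λ k → 𝟙 (k FinP.≟ Fin.zero))) (∑-vanish (allFin n) (λ _ → refl)))
allFin-enumerates (suc n) (Fin.suc j) = begin
  (∑[ k ∈ tabulate Fin.suc ] 𝟙 (k FinP.≟ Fin.suc j))     ≡⟨ ∑-tabulate {n = n} Fin.suc (λ k → 𝟙 (k FinP.≟ Fin.suc j)) ⟩
  (∑[ k ∈ allFin n ] 𝟙 (Fin.suc k FinP.≟ Fin.suc j))      ≡⟨ ∑-cong (allFin n) (λ k → 𝟙-cong (mk⇔ FinP.suc-injective (cong Fin.suc)) _ _) ⟩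
  (∑[ k ∈ allFin n ] 𝟙 (k FinP.≟ j))                      ≡⟨ allFin-enumerates n j ⟩
  1                                                       ∎
  where open ≡-Reasoning

↔-enumerates : ∀ {a} {A : Set a} {n} (_≟_ : DecidableEquality A) (e : Fin n ↔ A) →
  Enumerates _≟_ (map (Inverse.to e) (allFin n))
↔-enumerates {n = n} _≟_ e c =
  trans (∑-map to (allFin n) _)
        (trans (∑-cong (allFin n) (λ k → 𝟙-cong to≡c⇔ _ _)) (allFin-enumerates n (from c)))
  where
  open Inverse e using (to; from; strictlyInverseˡ; strictlyInverseʳ)
  to≡c⇔ : ∀ {k} → (to k ≡ c) ⇔ (k ≡ from c)
  to≡c⇔ {k} = mk⇔ (λ eq → trans (sym (strictlyInverseʳ k)) (cong from eq))
                  (λ eq → trans (cong to eq) (strictlyInverseˡ c))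

just-enumerates : ∀ {a} {A : Set a} (_≟_ : DecidableEquality A) xs →
  Enumerates _≟_ xs → Enumerates (MaybeP.≡-dec _≟_) (nothing ∷ map just xs)
just-enumerates _≟_ xs enum nothing =
  cong suc (trans (∑-map just xs _) (∑-vanish xs (λ _ → refl)))
just-enumerates _≟_ xs enum (just c) =
  trans (∑-map just xs _) (trans (∑-cong xs (λ x → 𝟙-cong (mk⇔ MaybeP.just-injective (cong just)) _ _)) (enum c))

-- Solving s·x + b = t·x + c in a commutative ring: it is (s - t)·x = c - b,
-- which a unit s - t solves uniquely.
module AffineEquation {ℓ₁ ℓ₂} (R : CommutativeRing ℓ₁ ℓ₂) where
  open CommutativeRing R hiding (refl; sym; trans; setoid)
  open CommutativeRing R using () renaming (refl to ≈-refl; trans to ≈-trans; setoid to ≈-setoid)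
  open import Algebra.Properties.Ring ring using (-‿distribˡ-*)
  open import Algebra.Properties.Group +-group using (∙-cancelʳ; x∙y⁻¹≈ε⇒x≈y)
  open import Algebra.Solver.CommutativeMonoid +-commutativeMonoid using (solve; _⊕_; _⊜_)
  open import Relation.Binary.Reasoning.Setoid ≈-setoid

  -- Adding k = -(t·x) - b to both sides turns the equation into (s - t)·x = c - b.
  private
    normalise-left : ∀ s t x b → (s * x + b) + (- (t * x) + - b) ≈ (s + - t) * x
    normalise-left s t x b = begin
      (s * x + b) + (- (t * x) + - b)   ≈⟨ solve 4 (λ u v w w' → (u ⊕ w) ⊕ (v ⊕ w') ⊜ (u ⊕ v) ⊕ (w ⊕ w')) ≈-refl (s * x) (- (t * x)) b (- b) ⟩
      (s * x + - (t * x)) + (b + - b)   ≈⟨ +-congˡ (-‿inverseʳ b) ⟩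
      (s * x + - (t * x)) + 0#          ≈⟨ +-identityʳ _ ⟩
      s * x + - (t * x)                 ≈⟨ +-congˡ (-‿distribˡ-* t x) ⟩
      s * x + - t * x                   ≈⟨ distribʳ x s (- t) ⟨
      (s + - t) * x                     ∎

    normalise-right : ∀ t x b c → (t * x + c) + (- (t * x) + - b) ≈ c + - b
    normalise-right t x b c = begin
      (t * x + c) + (- (t * x) + - b)   ≈⟨ solve 4 (λ u v w w' → (u ⊕ v) ⊕ (w ⊕ w') ⊜ (v ⊕ w') ⊕ (u ⊕ w)) ≈-refl (t * x) c (- (t * x)) (- b) ⟩
      (c + - b) + (t * x + - (t * x))   ≈⟨ +-congˡ (-‿inverseʳ (t * x)) ⟩
      (c + - b) + 0#                    ≈⟨ +-identityʳ _ ⟩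
      c + - b                           ∎

  affine⇔linear : ∀ s t b c x → (s * x + b ≈ t * x + c) ⇔ ((s + - t) * x ≈ c + - b)
  affine⇔linear s t b c x = mk⇔
    (λ eq → begin
      (s + - t) * x                     ≈⟨ normalise-left s t x b ⟨
      (s * x + b) + k                   ≈⟨ +-congʳ eq ⟩
      (t * x + c) + k                   ≈⟨ normalise-right t x b c ⟩
      c + - b                           ∎)
    (λ eq → ∙-cancelʳ k _ _ (begin
      (s * x + b) + k                   ≈⟨ normalise-left s t x b ⟩
      (s + - t) * x                     ≈⟨ eq ⟩
      c + - b                           ≈⟨ normalise-right t x b c ⟨
      (t * x + c) + k                   ∎))
    where k = - (t * x) + - b

  unit-equation⇔ : ∀ d e r x → d * e ≈ 1# → (d * x ≈ r) ⇔ (x ≈ e * r)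
  unit-equation⇔ d e r x de≈1 = mk⇔
    (λ eq → begin
      x                                 ≈⟨ *-identityˡ x ⟨
      1# * x                            ≈⟨ *-congʳ (≈-trans (*-comm e d) de≈1) ⟨
      (e * d) * x                       ≈⟨ *-assoc e d x ⟩
      e * (d * x)                       ≈⟨ *-congˡ eq ⟩
      e * r                             ∎)
    (λ eq → begin
      d * x                             ≈⟨ *-congˡ eq ⟩
      d * (e * r)                       ≈⟨ *-assoc d e r ⟨
      (d * e) * r                       ≈⟨ *-congʳ de≈1 ⟩
      1# * r                            ≈⟨ *-identityˡ r ⟩
      r                                 ∎)

  difference-nonzero : ∀ s t → ¬ (s ≈ t) → ¬ (s + - t ≈ 0#)
  difference-nonzero s t s≉t s-t≈0 = s≉t (x∙y⁻¹≈ε⇒x≈y s t s-t≈0)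

module Incidences {q : ℕ} (F : FiniteField q) where
  open FiniteField F using (Carrier; _≟_; enum; elems; Direction; directions; Point; points;
                            onLine?; isCommutativeRing; inverse)

  fieldRing : CommutativeRing _ _
  fieldRing = record { isCommutativeRing = isCommutativeRing }

  open CommutativeRing fieldRing using (_+_; _*_; -_)
  open AffineEquation fieldRing

  _≟ᴰ_ : DecidableEquality Direction
  _≟ᴰ_ = MaybeP.≡-dec _≟_

  elems-enumerates : Enumerates _≟_ elems
  elems-enumerates = ↔-enumerates _≟_ enum

  directions-enumerates : Enumerates _≟ᴰ_ directions
  directions-enumerates = just-enumerates _≟_ elems elems-enumerates

  length-elems : length elems ≡ q
  length-elems = trans (length-map (Inverse.to enum) (allFin q)) (length-tabulate (λ k → k))

  length-points : length points ≡ q ℕ.* q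
  length-points = trans (length-cartesianProduct elems elems) (cong₂ ℕ._*_ length-elems length-elems)

  length-directions : length directions ≡ suc q
  length-directions = cong suc (trans (length-map just elems) length-elems)

  unique-intersection : ∀ s t b c → ¬ (s ≡ t) →
    Σ Carrier (λ x₀ → ∀ x → (s * x + b ≡ t * x + c) ⇔ (x ≡ x₀))
  unique-intersection s t b c s≢t = e * (c + - b) , λ x →
    let forward  = affine⇔linear s t b c x
        backward = unit-equation⇔ d e (c + - b) x (proj₂ d-invertible)
    in mk⇔ (Equivalence.to backward ∘ Equivalence.to forward)
           (Equivalence.from forward ∘ Equivalence.from backward)
    where
    d = s + - t
    d-invertible = inverse d (difference-nonzero s t s≢t)
    e = proj₁ d-invertible

  on : Direction → Carrier → Point → ℕ
  on i b p = 𝟙 (onLine? i b p)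

  line-size : ∀ i b → (∑[ p ∈ points ] on i b p) ≡ q
  line-size (just s) b = begin
    (∑[ p ∈ points ] on (just s) b p)                   ≡⟨ ∑-cartesianProduct elems elems _ ⟩
    (∑[ x ∈ elems ] ∑[ y ∈ elems ] 𝟙 (y ≟ (s * x + b))) ≡⟨ ∑-cong elems (λ x → elems-enumerates (s * x + b)) ⟩
    (∑[ x ∈ elems ] 1)                                  ≡⟨ ∑-const elems 1 ⟩
    length elems ℕ.* 1                                  ≡⟨ trans (ℕP.*-identityʳ _) length-elems ⟩
    q                                                   ∎
    where open ≡-Reasoning
  line-size nothing b = begin
    (∑[ p ∈ points ] on nothing b p)                  ≡⟨ ∑-cartesianProduct elems elems _ ⟩
    (∑[ x ∈ elems ] ∑[ y ∈ elems ] 𝟙 (x ≟ b))         ≡⟨ ∑-swap elems elems _ ⟩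
    (∑[ y ∈ elems ] ∑[ x ∈ elems ] 𝟙 (x ≟ b))         ≡⟨ ∑-cong elems (λ _ → elems-enumerates b) ⟩
    (∑[ y ∈ elems ] 1)                                ≡⟨ ∑-const elems 1 ⟩
    length elems ℕ.* 1                                ≡⟨ trans (ℕP.*-identityʳ _) length-elems ⟩
    q                                                 ∎
    where open ≡-Reasoning

  vertical-meets-graph : ∀ b (g : Carrier → Carrier) →
    (∑[ x ∈ elems ] ∑[ y ∈ elems ] 𝟙 (x ≟ b) ℕ.* 𝟙 (y ≟ g x)) ≡ 1
  vertical-meets-graph b g = begin
    (∑[ x ∈ elems ] ∑[ y ∈ elems ] 𝟙 (x ≟ b) ℕ.* 𝟙 (y ≟ g x)) ≡⟨ ∑-cong elems (λ x → ∑-*ˡ elems (𝟙 (x ≟ b)) (λ y → 𝟙 (y ≟ g x))) ⟩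
    (∑[ x ∈ elems ] 𝟙 (x ≟ b) ℕ.* (∑[ y ∈ elems ] 𝟙 (y ≟ g x))) ≡⟨ ∑-cong elems (λ x → cong (𝟙 (x ≟ b) ℕ.*_) (elems-enumerates (g x))) ⟩
    (∑[ x ∈ elems ] 𝟙 (x ≟ b) ℕ.* 1)                          ≡⟨ sift _≟_ elems elems-enumerates b (λ _ → 1) ⟩
    1                                                          ∎
    where open ≡-Reasoning

  slanted-meet : ∀ s t b c → ¬ (s ≡ t) →
    (∑[ x ∈ elems ] ∑[ y ∈ elems ] 𝟙 (y ≟ (s * x + b)) ℕ.* 𝟙 (y ≟ (t * x + c))) ≡ 1
  slanted-meet s t b c s≢t = begin
    (∑[ x ∈ elems ] ∑[ y ∈ elems ] 𝟙 (y ≟ (s * x + b)) ℕ.* 𝟙 (y ≟ (t * x + c)))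
      ≡⟨ ∑-cong elems (λ x → sift _≟_ elems elems-enumerates (s * x + b) (λ y → 𝟙 (y ≟ (t * x + c)))) ⟩
    (∑[ x ∈ elems ] 𝟙 ((s * x + b) ≟ (t * x + c)))
      ≡⟨ ∑-cong elems (λ x → 𝟙-cong (proj₂ root x) _ _) ⟩
    (∑[ x ∈ elems ] 𝟙 (x ≟ proj₁ root))
      ≡⟨ elems-enumerates (proj₁ root) ⟩
    1 ∎
    where
    open ≡-Reasoning
    root = unique-intersection s t b c s≢t

  lines-meet-once : ∀ i j b c → ¬ (i ≡ j) → (∑[ p ∈ points ] on i b p ℕ.* on j c p) ≡ 1
  lines-meet-once nothing  nothing  b c i≢j = ⊥-elim (i≢j refl)
  lines-meet-once nothing  (just t) b c _   =
    trans (∑-cartesianProduct elems elems _) (vertical-meets-graph b (λ x → t * x + c))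
  lines-meet-once (just s) nothing  b c _   =
    trans (∑-cartesianProduct elems elems _)
          (trans (∑-cong elems (λ x → ∑-cong elems (λ y → ℕP.*-comm (𝟙 (y ≟ (s * x + b))) (𝟙 (x ≟ c)))))
                 (vertical-meets-graph c (λ x → s * x + b)))
  lines-meet-once (just s) (just t) b c i≢j =
    trans (∑-cartesianProduct elems elems _) (slanted-meet s t b c (i≢j ∘ cong just))

module Moments {q : ℕ} (F : FiniteField q) (B : FiniteField.Arrangement F) where
  open FiniteField F using (Direction; directions; points; Point; onLine?; linesThrough; x[_]^)
  open Incidences F

  t : Point → ℕ
  t = linesThrough B

  t-incidences : ∀ p → t p ≡ (∑[ i ∈ directions ] on i (B i) p)
  t-incidences p = length-filter (λ i → onLine? i (B i) p) directions

  x-indicator : ∀ m → x[ m ]^ B ≡ (∑[ p ∈ points ] 𝟙 (t p ℕP.≟ m))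
  x-indicator m = length-filter (λ p → t p ℕP.≟ m) points

  -- Σ_p t(p) = (q+1)q: each of the q+1 lines has q points.
  first-moment : (∑[ p ∈ points ] t p) ≡ suc q ℕ.* q
  first-moment = begin
    (∑[ p ∈ points ] t p)                               ≡⟨ ∑-cong points t-incidences ⟩
    (∑[ p ∈ points ] ∑[ i ∈ directions ] on i (B i) p)  ≡⟨ ∑-swap points directions _ ⟩
    (∑[ i ∈ directions ] ∑[ p ∈ points ] on i (B i) p)  ≡⟨ ∑-cong directions (λ i → line-size i (B i)) ⟩
    (∑[ i ∈ directions ] q)                             ≡⟨ ∑-const directions q ⟩
    length directions ℕ.* q                             ≡⟨ cong (ℕ._* q) length-directions ⟩
    suc q ℕ.* q                                         ∎
    where open ≡-Reasoning

  common : Direction → Direction → ℕ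
  common i j = ∑[ p ∈ points ] on i (B i) p ℕ.* on j (B j) p

  -- q common points when i = j, one otherwise; compensated by the indicator of i = j.
  common-points : ∀ i j → common i j ℕ.+ 𝟙 (j ≟ᴰ i) ≡ 1 ℕ.+ q ℕ.* 𝟙 (j ≟ᴰ i)
  common-points i j with j ≟ᴰ i
  ... | yes refl = trans (cong (ℕ._+ 1) (trans (∑-cong points (λ p → 𝟙-idem (onLine? i (B i) p))) (line-size i (B i))))
                         (q+1≡1+q*1 q)
    where
    q+1≡1+q*1 : ∀ q → q ℕ.+ 1 ≡ 1 ℕ.+ q ℕ.* 1
    q+1≡1+q*1 = solve-∀
  ... | no j≢i   = trans (cong (ℕ._+ 0) (lines-meet-once i j (B i) (B j) (j≢i ∘ sym)))
                         (cong suc (sym (ℕP.*-zeroʳ q)))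

  common-row : ∀ i → (∑[ j ∈ directions ] common i j) ≡ q ℕ.+ q
  common-row i = ℕP.+-cancelʳ-≡ 1 _ _ (begin
    (∑[ j ∈ directions ] common i j) ℕ.+ 1
      ≡⟨ cong ((∑[ j ∈ directions ] common i j) ℕ.+_) (directions-enumerates i) ⟨
    (∑[ j ∈ directions ] common i j) ℕ.+ (∑[ j ∈ directions ] 𝟙 (j ≟ᴰ i))
      ≡⟨ ∑-+ directions (common i) _ ⟨
    (∑[ j ∈ directions ] (common i j ℕ.+ 𝟙 (j ≟ᴰ i)))
      ≡⟨ ∑-cong directions (common-points i) ⟩
    (∑[ j ∈ directions ] (1 ℕ.+ q ℕ.* 𝟙 (j ≟ᴰ i)))
      ≡⟨ ∑-+ directions (λ _ → 1) _ ⟩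
    (∑[ j ∈ directions ] 1) ℕ.+ (∑[ j ∈ directions ] q ℕ.* 𝟙 (j ≟ᴰ i))
      ≡⟨ cong₂ ℕ._+_ (trans (∑-const directions 1) (trans (ℕP.*-identityʳ _) length-directions))
                     (trans (∑-*ˡ directions q _) (cong (q ℕ.*_) (directions-enumerates i))) ⟩
    suc q ℕ.+ q ℕ.* 1
      ≡⟨ rearrange q ⟩
    q ℕ.+ q ℕ.+ 1 ∎)
    where
    open ≡-Reasoning
    rearrange : ∀ q → suc q ℕ.+ q ℕ.* 1 ≡ q ℕ.+ q ℕ.+ 1
    rearrange = solve-∀

  second-moment : (∑[ p ∈ points ] t p ℕ.* t p) ≡ suc q ℕ.* (q ℕ.+ q)
  second-moment = begin
    (∑[ p ∈ points ] t p ℕ.* t p)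
      ≡⟨ ∑-cong points square-incidences ⟩
    (∑[ p ∈ points ] ∑[ i ∈ directions ] ∑[ j ∈ directions ] on i (B i) p ℕ.* on j (B j) p)
      ≡⟨ ∑-swap points directions _ ⟩
    (∑[ i ∈ directions ] ∑[ p ∈ points ] ∑[ j ∈ directions ] on i (B i) p ℕ.* on j (B j) p)
      ≡⟨ ∑-cong directions (λ i → ∑-swap points directions _) ⟩
    (∑[ i ∈ directions ] ∑[ j ∈ directions ] common i j)
      ≡⟨ ∑-cong directions common-row ⟩
    (∑[ i ∈ directions ] (q ℕ.+ q))
      ≡⟨ ∑-const directions (q ℕ.+ q) ⟩
    length directions ℕ.* (q ℕ.+ q)
      ≡⟨ cong (ℕ._* (q ℕ.+ q)) length-directions ⟩
    suc q ℕ.* (q ℕ.+ q) ∎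
    where
    open ≡-Reasoning
    square-incidences : ∀ p → t p ℕ.* t p ≡ (∑[ i ∈ directions ] ∑[ j ∈ directions ] on i (B i) p ℕ.* on j (B j) p)
    square-incidences p = begin
      t p ℕ.* t p                                        ≡⟨ cong (ℕ._* t p) (t-incidences p) ⟩
      (∑[ i ∈ directions ] on i (B i) p) ℕ.* t p         ≡⟨ ∑-*ʳ directions (t p) (λ i → on i (B i) p) ⟨
      (∑[ i ∈ directions ] on i (B i) p ℕ.* t p)         ≡⟨ ∑-cong directions (λ i → trans (cong (on i (B i) p ℕ.*_) (t-incidences p)) (sym (∑-*ˡ directions (on i (B i) p) (λ j → on j (B j) p)))) ⟩
      (∑[ i ∈ directions ] ∑[ j ∈ directions ] on i (B i) p ℕ.* on j (B j) p) ∎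

small-values-exclusive : ∀ n → 𝟙 (n ℕP.≟ 0) ℕ.+ 𝟙 (n ℕP.≟ 1) ℕ.+ 𝟙 (n ℕP.≟ 2) ℕ.≤ 1
small-values-exclusive 0 = s≤s z≤n
small-values-exclusive 1 = s≤s z≤n
small-values-exclusive 2 = s≤s z≤n
small-values-exclusive (suc (suc (suc k))) = z≤n

-- 3[n=0] - [n=2] ≤ (n-1)(n-3) = n² - 4n + 3, with negative terms moved across.
quadratic-bound : ∀ n → 3 ℕ.* 𝟙 (n ℕP.≟ 0) ℕ.+ 4 ℕ.* n ℕ.≤ n ℕ.* n ℕ.+ 3 ℕ.+ 𝟙 (n ℕP.≟ 2)
quadratic-bound 0 = ℕP.≤-refl
quadratic-bound 1 = ℕP.≤-refl
quadratic-bound 2 = ℕP.≤-refl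
quadratic-bound (suc (suc (suc k))) =
  subst₂ ℕ._≤_ (left k) (right k) (ℕP.m≤m+n (12 ℕ.+ 4 ℕ.* k) (2 ℕ.* k ℕ.+ k ℕ.* k))
  where
  left : ∀ k → 12 ℕ.+ 4 ℕ.* k ≡ 3 ℕ.* 0 ℕ.+ 4 ℕ.* (3 ℕ.+ k)
  left = solve-∀
  right : ∀ k → 12 ℕ.+ 4 ℕ.* k ℕ.+ (2 ℕ.* k ℕ.+ k ℕ.* k) ≡ (3 ℕ.+ k) ℕ.* (3 ℕ.+ k) ℕ.+ 3 ℕ.+ 0
  right = solve-∀

linear-bound : ∀ n → 3 ℕ.≤ 3 ℕ.* 𝟙 (n ℕP.≟ 0) ℕ.+ 2 ℕ.* 𝟙 (n ℕP.≟ 1) ℕ.+ 𝟙 (n ℕP.≟ 2) ℕ.+ n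
linear-bound 0 = ℕP.≤-refl
linear-bound 1 = ℕP.≤-refl
linear-bound 2 = ℕP.≤-refl
linear-bound (suc (suc (suc k))) = s≤s (s≤s (s≤s z≤n))

square : ∀ q → q ℕ.^ 2 ≡ q ℕ.* q
square q = cong (q ℕ.*_) (ℕP.*-identityʳ q)

module Inequalities {q : ℕ} (F : FiniteField q) (B : FiniteField.Arrangement F) where
  open FiniteField F using (points; x[_]^)
  open Incidences F using (length-points)
  open Moments F B using (t; x-indicator; first-moment; second-moment)

  weighted-count : ∀ c m → (∑[ p ∈ points ] c ℕ.* 𝟙 (t p ℕP.≟ m)) ≡ c ℕ.* x[ m ]^ B
  weighted-count c m = trans (∑-*ˡ points c _) (cong (c ℕ.*_) (sym (x-indicator m)))

  count : ∀ m → (∑[ p ∈ points ] 𝟙 (t p ℕP.≟ m)) ≡ x[ m ]^ B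
  count m = sym (x-indicator m)

  constant-sum : ∀ c → (∑[ p ∈ points ] c) ≡ q ℕ.* q ℕ.* c
  constant-sum c = trans (∑-const points c) (cong (ℕ._* c) length-points)

  small-counts : x[ 0 ]^ B ℕ.+ x[ 1 ]^ B ℕ.+ x[ 2 ]^ B ℕ.≤ q ℕ.^ 2
  small-counts = subst₂ ℕ._≤_ summed-left summed-right (∑-mono points (λ p → small-values-exclusive (t p)))
    where
    summed-left : (∑[ p ∈ points ] 𝟙 (t p ℕP.≟ 0) ℕ.+ 𝟙 (t p ℕP.≟ 1) ℕ.+ 𝟙 (t p ℕP.≟ 2))
                ≡ x[ 0 ]^ B ℕ.+ x[ 1 ]^ B ℕ.+ x[ 2 ]^ B
    summed-left = trans (∑-+ points _ _) (cong₂ ℕ._+_ (trans (∑-+ points _ _) (cong₂ ℕ._+_ (count 0) (count 1))) (count 2))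
    summed-right : (∑[ p ∈ points ] 1) ≡ q ℕ.^ 2
    summed-right = trans (constant-sum 1) (trans (ℕP.*-identityʳ _) (sym (square q)))

  -- Summing quadratic-bound: 3x₀ - x₂ ≤ Σ_p (t-1)(t-3) = q² - 2q.
  second-bound : 3 ℕ.* x[ 0 ]^ B ℕ.+ 2 ℕ.* q ℕ.≤ q ℕ.^ 2 ℕ.+ x[ 2 ]^ B
  second-bound = subst (λ s → 3 ℕ.* x[ 0 ]^ B ℕ.+ 2 ℕ.* q ℕ.≤ s ℕ.+ x[ 2 ]^ B) (sym (square q))
    (ℕP.+-cancelʳ-≤ (2 ℕ.* q ℕ.+ 4 ℕ.* (q ℕ.* q)) _ _
      (subst₂ ℕ._≤_ summed-left summed-right (∑-mono points (λ p → quadratic-bound (t p)))))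
    where
    open ≡-Reasoning
    summed-left : (∑[ p ∈ points ] 3 ℕ.* 𝟙 (t p ℕP.≟ 0) ℕ.+ 4 ℕ.* t p)
                ≡ 3 ℕ.* x[ 0 ]^ B ℕ.+ 2 ℕ.* q ℕ.+ (2 ℕ.* q ℕ.+ 4 ℕ.* (q ℕ.* q))
    summed-left = begin
      (∑[ p ∈ points ] 3 ℕ.* 𝟙 (t p ℕP.≟ 0) ℕ.+ 4 ℕ.* t p)
        ≡⟨ ∑-+ points _ _ ⟩
      (∑[ p ∈ points ] 3 ℕ.* 𝟙 (t p ℕP.≟ 0)) ℕ.+ (∑[ p ∈ points ] 4 ℕ.* t p)
        ≡⟨ cong₂ ℕ._+_ (weighted-count 3 0) (trans (∑-*ˡ points 4 t) (cong (4 ℕ.*_) first-moment)) ⟩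
      3 ℕ.* x[ 0 ]^ B ℕ.+ 4 ℕ.* (suc q ℕ.* q)
        ≡⟨ regroup (x[ 0 ]^ B) q ⟩
      3 ℕ.* x[ 0 ]^ B ℕ.+ 2 ℕ.* q ℕ.+ (2 ℕ.* q ℕ.+ 4 ℕ.* (q ℕ.* q)) ∎
      where
      regroup : ∀ x q → 3 ℕ.* x ℕ.+ 4 ℕ.* (suc q ℕ.* q) ≡ 3 ℕ.* x ℕ.+ 2 ℕ.* q ℕ.+ (2 ℕ.* q ℕ.+ 4 ℕ.* (q ℕ.* q))
      regroup = solve-∀
    summed-right : (∑[ p ∈ points ] t p ℕ.* t p ℕ.+ 3 ℕ.+ 𝟙 (t p ℕP.≟ 2))
                 ≡ q ℕ.* q ℕ.+ x[ 2 ]^ B ℕ.+ (2 ℕ.* q ℕ.+ 4 ℕ.* (q ℕ.* q))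
    summed-right = begin
      (∑[ p ∈ points ] t p ℕ.* t p ℕ.+ 3 ℕ.+ 𝟙 (t p ℕP.≟ 2))
        ≡⟨ ∑-+ points _ _ ⟩
      (∑[ p ∈ points ] t p ℕ.* t p ℕ.+ 3) ℕ.+ (∑[ p ∈ points ] 𝟙 (t p ℕP.≟ 2))
        ≡⟨ cong₂ ℕ._+_ (trans (∑-+ points _ _) (cong₂ ℕ._+_ second-moment (constant-sum 3))) (count 2) ⟩
      suc q ℕ.* (q ℕ.+ q) ℕ.+ q ℕ.* q ℕ.* 3 ℕ.+ x[ 2 ]^ B
        ≡⟨ regroup (x[ 2 ]^ B) q ⟩
      q ℕ.* q ℕ.+ x[ 2 ]^ B ℕ.+ (2 ℕ.* q ℕ.+ 4 ℕ.* (q ℕ.* q)) ∎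
      where
      regroup : ∀ x q → suc q ℕ.* (q ℕ.+ q) ℕ.+ q ℕ.* q ℕ.* 3 ℕ.+ x ≡ q ℕ.* q ℕ.+ x ℕ.+ (2 ℕ.* q ℕ.+ 4 ℕ.* (q ℕ.* q))
      regroup = solve-∀

  -- Summing linear-bound: 3q² - Σ_p t(p) ≤ 3x₀ + 2x₁ + x₂.
  third-bound : 2 ℕ.* q ℕ.^ 2 ℕ.≤ 3 ℕ.* x[ 0 ]^ B ℕ.+ 2 ℕ.* x[ 1 ]^ B ℕ.+ x[ 2 ]^ B ℕ.+ q
  third-bound = subst (λ s → 2 ℕ.* s ℕ.≤ 3 ℕ.* x[ 0 ]^ B ℕ.+ 2 ℕ.* x[ 1 ]^ B ℕ.+ x[ 2 ]^ B ℕ.+ q) (sym (square q))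
    (ℕP.+-cancelʳ-≤ (q ℕ.* q) _ _
      (subst₂ ℕ._≤_ summed-left summed-right (∑-mono points (λ p → linear-bound (t p)))))
    where
    open ≡-Reasoning
    summed-left : (∑[ p ∈ points ] 3) ≡ 2 ℕ.* (q ℕ.* q) ℕ.+ q ℕ.* q
    summed-left = trans (constant-sum 3) (regroup q)
      where
      regroup : ∀ q → q ℕ.* q ℕ.* 3 ≡ 2 ℕ.* (q ℕ.* q) ℕ.+ q ℕ.* q
      regroup = solve-∀
    summed-right : (∑[ p ∈ points ] 3 ℕ.* 𝟙 (t p ℕP.≟ 0) ℕ.+ 2 ℕ.* 𝟙 (t p ℕP.≟ 1) ℕ.+ 𝟙 (t p ℕP.≟ 2) ℕ.+ t p)
                 ≡ 3 ℕ.* x[ 0 ]^ B ℕ.+ 2 ℕ.* x[ 1 ]^ B ℕ.+ x[ 2 ]^ B ℕ.+ q ℕ.+ q ℕ.* q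
    summed-right = begin
      (∑[ p ∈ points ] 3 ℕ.* 𝟙 (t p ℕP.≟ 0) ℕ.+ 2 ℕ.* 𝟙 (t p ℕP.≟ 1) ℕ.+ 𝟙 (t p ℕP.≟ 2) ℕ.+ t p)
        ≡⟨ ∑-+ points _ t ⟩
      (∑[ p ∈ points ] 3 ℕ.* 𝟙 (t p ℕP.≟ 0) ℕ.+ 2 ℕ.* 𝟙 (t p ℕP.≟ 1) ℕ.+ 𝟙 (t p ℕP.≟ 2)) ℕ.+ (∑[ p ∈ points ] t p)
        ≡⟨ cong₂ ℕ._+_ (trans (∑-+ points _ _) (cong₂ ℕ._+_ (trans (∑-+ points _ _)
                         (cong₂ ℕ._+_ (weighted-count 3 0) (weighted-count 2 1))) (count 2))) first-moment ⟩
      3 ℕ.* x[ 0 ]^ B ℕ.+ 2 ℕ.* x[ 1 ]^ B ℕ.+ x[ 2 ]^ B ℕ.+ suc q ℕ.* q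
        ≡⟨ ℕP.+-assoc (3 ℕ.* x[ 0 ]^ B ℕ.+ 2 ℕ.* x[ 1 ]^ B ℕ.+ x[ 2 ]^ B) q (q ℕ.* q) ⟨
      3 ℕ.* x[ 0 ]^ B ℕ.+ 2 ℕ.* x[ 1 ]^ B ℕ.+ x[ 2 ]^ B ℕ.+ q ℕ.+ q ℕ.* q ∎

-- The statement lives in ℤ; its arithmetic operators are opened only from here on.
open import Data.Nat using (ℕ; _^_)
open import Data.Integer using (ℤ; +_; _+_; _-_; _*_; _≤_; +≤+; -_)
import Data.Integer.Properties as ℤP
import Data.Integer.Tactic.RingSolver as ℤSolver

difference-bound : ∀ a b c d → a ℕ.+ d ℕ.≤ b ℕ.+ c → + a - + c ≤ + b - + d
difference-bound a b c d a+d≤b+c =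
  subst₂ _≤_ (cancel (+ a) (+ c) (+ d)) (cancel′ (+ b) (+ c) (+ d))
    (ℤP.+-monoˡ-≤ (- (+ c + + d)) (subst₂ _≤_ (ℤP.pos-+ a d) (ℤP.pos-+ b c) (+≤+ a+d≤b+c)))
  where
  cancel : ∀ a c d → a + d + - (c + d) ≡ a - c
  cancel = ℤSolver.solve-∀
  cancel′ : ∀ b c d → b + c + - (c + d) ≡ b - d
  cancel′ = ℤSolver.solve-∀

pos-+₃ : ∀ a b c → + (a ℕ.+ b ℕ.+ c) ≡ + a + + b + + c
pos-+₃ a b c = trans (ℤP.pos-+ (a ℕ.+ b) c) (cong (_+ + c) (ℤP.pos-+ a b))

proposition5 : (q : ℕ) (F : FiniteField q) (B : FiniteField.Arrangement F) →
    let open FiniteField F using (x[_]^) in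
    (+ (x[ 0 ]^ B) + + (x[ 1 ]^ B) + + (x[ 2 ]^ B) ≤ + (q ^ 2))
    × (+ 3 * + (x[ 0 ]^ B) - + (x[ 2 ]^ B) ≤ + (q ^ 2) - + 2 * + q)
    × (+ 2 * + (q ^ 2) - + q ≤ + 3 * + (x[ 0 ]^ B) + + 2 * + (x[ 1 ]^ B) + + (x[ 2 ]^ B))
proposition5 q F B = first , second , third
  where
  open FiniteField F using (x[_]^)
  open Inequalities F B using (small-counts; second-bound; third-bound)
  x₀ = x[ 0 ]^ B
  x₁ = x[ 1 ]^ B
  x₂ = x[ 2 ]^ B

  first : + x₀ + + x₁ + + x₂ ≤ + (q ^ 2)
  first = subst (_≤ + (q ^ 2)) (pos-+₃ x₀ x₁ x₂) (+≤+ small-counts)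

  second : + 3 * + x₀ - + x₂ ≤ + (q ^ 2) - + 2 * + q
  second = subst₂ _≤_ (cong (_- + x₂) (ℤP.pos-* 3 x₀)) (cong (λ z → + (q ^ 2) - z) (ℤP.pos-* 2 q))
                  (difference-bound (3 ℕ.* x₀) (q ^ 2) x₂ (2 ℕ.* q) second-bound)

  third : + 2 * + (q ^ 2) - + q ≤ + 3 * + x₀ + + 2 * + x₁ + + x₂
  third = subst₂ _≤_ (cong (_- + q) (ℤP.pos-* 2 (q ^ 2))) weighted-sum
                 (difference-bound (2 ℕ.* q ^ 2) (3 ℕ.* x₀ ℕ.+ 2 ℕ.* x₁ ℕ.+ x₂) q 0
                   (ℕP.≤-trans (ℕP.≤-reflexive (ℕP.+-identityʳ _)) third-bound))
    where
    weighted-sum : + (3 ℕ.* x₀ ℕ.+ 2 ℕ.* x₁ ℕ.+ x₂) - + 0 ≡ + 3 * + x₀ + + 2 * + x₁ + + x₂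
    weighted-sum = trans (ℤP.+-identityʳ _) (trans (pos-+₃ (3 ℕ.* x₀) (2 ℕ.* x₁) x₂)
                     (cong₂ (λ u v → u + v + + x₂) (ℤP.pos-* 3 x₀) (ℤP.pos-* 2 x₁)))
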